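{- Let $K_{a,b}$ be the complete bipartite graph with sides $L$ ($|L|=a$) and $R$ ($|R|=b$), and let $\sigma$ be a confined position of the parallel chip-firing game on $K_{a,b}$. Let $t$ be the smallest positive integer for which there exist integers $m\ge0$ and $k\ge 0$ such that $\alpha_t(L,m)=ka$ and $F_v(m)=F_v(m+t)$ for all $v\in L$. Then $p(\sigma)=t$.
   Context: Parallel chip-firing game: a position $\sigma$ assigns a nonnegative integer to each vertex; at each step every vertex $v$ with at least $\deg(v)$ chips simultaneously sends one chip to each neighbor. $U$ is the step operator, $U^0\sigma=\sigma$, $U^m\sigma=U(U^{m-1}\sigma)$. $\Phi_\sigma(v)$ is the number of neighbors $w$ of $v$ with $\sigma(w)\ge\deg(w)$. A position is confined if every vertex satisfies $\Phi_\sigma(v)\le\sigma(v)\le\Phi_\sigma(v)+\deg(v)-1$. $F_v(t)=1$ if $U^t\sigma(v)\ge\deg(v)$ and $F_v(t)=0$ otherwise. $u_t(\sigma,v)=\sum_{s=0}^{t-1}F_v(s)$, and $\alpha_t(L,m)=\sum_{v\in L}(u_{m+t}(\sigma,v)-u_m(\sigma,v))$. The period $p(\sigma)$ is the least positive integer $p$ with $U^s\sigma=U^{s+p}\sigma$ for all sufficiently large $s$. -}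

module Defs where

open import Data.Nat using (ℕ; zero; suc; _+_; _*_; _∸_; _≤_; _<_; _≤ᵇ_)
open import Data.Bool using (Bool; true; false; if_then_else_)
open import Data.Fin using (Fin)
open import Data.Sum using (_⊎_; inj₁; inj₂)
open import Data.Product using (Σ; _×_; ∃; _,_)
open import Relation.Binary.PropositionalEquality using (_≡_)

sumFin : (n : ℕ) → (Fin n → ℕ) → ℕ
sumFin zero    f = 0
sumFin (suc n) f = f Fin.zero + sumFin n (λ i → f (Fin.suc i))

sumBelow : ℕ → (ℕ → ℕ) → ℕ
sumBelow zero    f = 0
sumBelow (suc t) f = sumBelow t f + f t

-- Vertices of K_{a,b}: inj₁ i ∈ L (|L| = a), inj₂ j ∈ R (|R| = b).
Vertex : ℕ → ℕ → Set
Vertex a b = Fin a ⊎ Fin b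

deg : ∀ {a b} → Vertex a b → ℕ
deg {a} {b} (inj₁ _) = b
deg {a} {b} (inj₂ _) = a

Position : ℕ → ℕ → Set
Position a b = Vertex a b → ℕ

fires : ∀ {a b} → Position a b → Vertex a b → Bool
fires σ v = deg v ≤ᵇ σ v

ind : Bool → ℕ
ind true  = 1
ind false = 0

Φ : ∀ {a b} → Position a b → Vertex a b → ℕ
Φ {a} {b} σ (inj₁ _) = sumFin b (λ j → ind (fires σ (inj₂ j)))
Φ {a} {b} σ (inj₂ _) = sumFin a (λ i → ind (fires σ (inj₁ i)))

U : ∀ {a b} → Position a b → Position a b
U σ v = (if fires σ v then σ v ∸ deg v else σ v) + Φ σ v

Uⁿ : ∀ {a b} → ℕ → Position a b → Position a b
Uⁿ zero    σ = σ
Uⁿ (suc m) σ = U (Uⁿ m σ)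

-- Confined: Φ(v) ≤ σ(v) ≤ Φ(v) + deg(v) - 1, the upper bound written as σ(v) < Φ(v) + deg(v).
Confined : ∀ {a b} → Position a b → Set
Confined σ = ∀ v → Φ σ v ≤ σ v × σ v < Φ σ v + deg v

F : ∀ {a b} → Position a b → Vertex a b → ℕ → ℕ
F σ v t = ind (fires (Uⁿ t σ) v)

u : ∀ {a b} → ℕ → Position a b → Vertex a b → ℕ
u t σ v = sumBelow t (F σ v)

α : ∀ {a b} → Position a b → ℕ → ℕ → ℕ
α {a} {b} σ t m = sumFin a (λ i → u (m + t) σ (inj₁ i) ∸ u m σ (inj₁ i))

-- p is a (not necessarily least) eventual period of σ.
IsPeriod : ∀ {a b} → Position a b → ℕ → Set
IsPeriod σ p = 0 < p × ∃ λ s₀ → ∀ s → s₀ ≤ s → ∀ v → Uⁿ s σ v ≡ Uⁿ (s + p) σ v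

GoodT : ∀ {a b} → Position a b → ℕ → Set
GoodT {a} {b} σ t = 0 < t × ∃ λ m → ∃ λ k →
  (α σ t m ≡ k * a) × (∀ (i : Fin a) → F σ (inj₁ i) m ≡ F σ (inj₁ i) (m + t))

IsLeast : (ℕ → Set) → ℕ → Set
IsLeast P n = P n × (∀ n' → P n' → n ≤ n')

module Submission where

-- We show that the condition on t and "t is an eventual period" define the
-- same set of t, so they have the same least element.  The ingredients,
-- developed in this order, are:
-- (1) sums over Fin n and over time windows;
-- (2) residues: a vertex holding x < 2d chips keeps x mod d after firing;
-- (3) iteration of U and boundedness τ(v) < 2·deg(v), which confined
--     positions satisfy along their whole orbit;
-- (4) chip conservation over a window of t steps from τ:
--     U^t τ(v) + deg(v)·(firings of v) = τ(v) + (chips received by v);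
-- (5) in K_{a,b}, v receives one chip per firing on the opposite side.
-- Period ⇒ condition: in a returning window b·(firings of i) equals the
-- number of firings on R for every i ∈ L, so α is a multiple of a.
-- Condition ⇒ period: each R-vertex receives a·k chips, so by (2) it
-- returns one step later and fires k times; then each L-vertex receives b·k
-- chips and returns one step after that; two steps later every vertex fires
-- exactly k times in the window, which by (4) returns the position.

open import Defs
open import Data.Nat using (ℕ; zero; suc; _+_; _*_; _∸_; _≤_; _<_; _≤ᵇ_; z≤n; s≤s; NonZero)
open import Data.Nat.Properties
open import Data.Nat.DivMod using (_%_; m<n⇒m%n≡m; [m+n]%n≡m%n; %-remove-+ʳ; m%n<n)
open import Data.Nat.Divisibility using (m∣m*n)
open import Data.Nat.Solver using (module +-*-Solver)
open import Algebra.Properties.CommutativeSemigroup +-commutativeSemigroup using (interchange)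
open import Data.Bool using (Bool; true; false; if_then_else_; T)
open import Data.Fin using (Fin)
open import Data.Sum using (inj₁; inj₂)
open import Data.Product using (_×_; ∃; _,_; proj₁; proj₂)
open import Relation.Binary.PropositionalEquality

open +-*-Solver using (solve; _:+_; _:=_)

private variable
  a b k t : ℕ

sumFin-cong : ∀ n {f g : Fin n → ℕ} → (∀ i → f i ≡ g i) → sumFin n f ≡ sumFin n g
sumFin-cong zero    _ = refl
sumFin-cong (suc n) h = cong₂ _+_ (h Fin.zero) (sumFin-cong n (λ i → h (Fin.suc i)))

sumFin-+ : ∀ n (f g : Fin n → ℕ) → sumFin n (λ i → f i + g i) ≡ sumFin n f + sumFin n g
sumFin-+ zero    f g = refl
sumFin-+ (suc n) f g =
  trans (cong (f Fin.zero + g Fin.zero +_) (sumFin-+ n (λ i → f (Fin.suc i)) (λ i → g (Fin.suc i))))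
        (interchange (f Fin.zero) (g Fin.zero) _ _)

sumFin-const : ∀ n c → sumFin n (λ _ → c) ≡ n * c
sumFin-const zero    c = refl
sumFin-const (suc n) c = cong (c +_) (sumFin-const n c)

sumFin-ind≤ : ∀ n (h : Fin n → Bool) → sumFin n (λ i → ind (h i)) ≤ n
sumFin-ind≤ zero    h = z≤n
sumFin-ind≤ (suc n) h with h Fin.zero
... | true  = s≤s (sumFin-ind≤ n (λ i → h (Fin.suc i)))
... | false = m≤n⇒m≤1+n (sumFin-ind≤ n (λ i → h (Fin.suc i)))

sumFin-uniform : ∀ n (f : Fin n → ℕ) → (∀ i j → f i ≡ f j) → ∃ λ k → sumFin n f ≡ k * n
sumFin-uniform zero    f _  = 0 , refl
sumFin-uniform (suc n) f eq = f Fin.zero ,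
  trans (sumFin-cong (suc n) (λ i → eq i Fin.zero))
        (trans (sumFin-const (suc n) (f Fin.zero)) (*-comm (suc n) (f Fin.zero)))

sumBelow-cong : ∀ t {f g : ℕ → ℕ} → (∀ r → f r ≡ g r) → sumBelow t f ≡ sumBelow t g
sumBelow-cong zero    _ = refl
sumBelow-cong (suc t) h = cong₂ _+_ (sumBelow-cong t h) (h t)

sumBelow-split : ∀ (f : ℕ → ℕ) m t → sumBelow (m + t) f ≡ sumBelow m f + sumBelow t (λ r → f (m + r))
sumBelow-split f m zero    rewrite +-identityʳ m = sym (+-identityʳ _)
sumBelow-split f m (suc t) rewrite +-suc m t =
  trans (cong (_+ f (m + t)) (sumBelow-split f m t)) (+-assoc (sumBelow m f) _ _)

sumBelow-slide : ∀ (g : ℕ → ℕ) t → g 0 ≡ g t → sumBelow t (λ r → g (suc r)) ≡ sumBelow t g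
sumBelow-slide g t edge = +-cancelˡ-≡ (g 0) _ _ (begin
  g 0 + sumBelow t (λ r → g (suc r)) ≡⟨ sym (sumBelow-split g 1 t) ⟩
  sumBelow t g + g t                 ≡⟨ cong (sumBelow t g +_) (sym edge) ⟩
  sumBelow t g + g 0                 ≡⟨ +-comm (sumBelow t g) (g 0) ⟩
  g 0 + sumBelow t g                 ∎)
  where open ≡-Reasoning

sumBelow-sumFin : ∀ t n (g : ℕ → Fin n → ℕ) →
  sumBelow t (λ r → sumFin n (g r)) ≡ sumFin n (λ j → sumBelow t (λ r → g r j))
sumBelow-sumFin zero    n g = sym (trans (sumFin-const n 0) (*-zeroʳ n))
sumBelow-sumFin (suc t) n g =
  trans (cong (_+ sumFin n (g t)) (sumBelow-sumFin t n g))
        (sym (sumFin-+ n (λ j → sumBelow t (λ r → g r j)) (g t)))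

-- Chips left on a vertex of degree d holding x chips after one step,
-- before it receives anything: U τ v ≡ resid (deg v) (τ v) + Φ τ v.
resid : ℕ → ℕ → ℕ
resid d x = if d ≤ᵇ x then x ∸ d else x

resid-mod : ∀ {d x} .{{_ : NonZero d}} → x < d + d → resid d x ≡ x % d
resid-mod {d} {x} x<2d with d ≤ᵇ x in fired
... | true  = sym (begin
  x % d             ≡⟨ cong (_% d) (sym (m∸n+n≡m d≤x)) ⟩
  (x ∸ d + d) % d   ≡⟨ [m+n]%n≡m%n (x ∸ d) d ⟩
  (x ∸ d) % d       ≡⟨ m<n⇒m%n≡m (m<n+o⇒m∸n<o x d x<2d) ⟩
  x ∸ d             ∎)
  where open ≡-Reasoning
        d≤x = ≤ᵇ⇒≤ d x (subst T (sym fired) _)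
... | false = sym (m<n⇒m%n≡m (≰⇒> λ d≤x → subst T fired (≤⇒≤ᵇ d≤x)))

resid-< : ∀ {d x} → x < d + d → resid d x < d
resid-< {suc d} {x} x<2d = subst (_< suc d) (sym (resid-mod x<2d)) (m%n<n x (suc d))

resid-cong : ∀ {d x y} p q → x < d + d → y < d + d → x + d * p ≡ y + d * q → resid d x ≡ resid d y
resid-cong {suc d} {x} {y} p q x<2d y<2d e = begin
  resid (suc d) x         ≡⟨ resid-mod x<2d ⟩
  x % suc d               ≡⟨ sym (%-remove-+ʳ x (m∣m*n p)) ⟩
  (x + suc d * p) % suc d ≡⟨ cong (_% suc d) e ⟩
  (y + suc d * q) % suc d ≡⟨ %-remove-+ʳ y (m∣m*n q) ⟩
  y % suc d               ≡⟨ sym (resid-mod y<2d) ⟩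
  resid (suc d) y         ∎
  where open ≡-Reasoning

Uⁿ-comm : ∀ t (τ : Position a b) → Uⁿ t (U τ) ≡ U (Uⁿ t τ)
Uⁿ-comm zero    τ = refl
Uⁿ-comm (suc t) τ = cong U (Uⁿ-comm t τ)

Uⁿ-+ : ∀ m t (σ : Position a b) → Uⁿ (m + t) σ ≡ Uⁿ t (Uⁿ m σ)
Uⁿ-+ zero    t σ = refl
Uⁿ-+ (suc m) t σ = trans (cong U (Uⁿ-+ m t σ)) (sym (Uⁿ-comm t (Uⁿ m σ)))

ind-fires-cong : ∀ (ρ ρ' : Position a b) v → ρ v ≡ ρ' v → ind (fires ρ v) ≡ ind (fires ρ' v)
ind-fires-cong ρ ρ' v = cong (λ x → ind (deg v ≤ᵇ x))

U-cong : ∀ {τ τ' : Position a b} → (∀ v → τ v ≡ τ' v) → ∀ v → U τ v ≡ U τ' v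
U-cong {a} {b} {τ} {τ'} e v = cong₂ _+_ (cong (resid (deg v)) (e v)) (Φ-cong v)
  where
  Φ-cong : ∀ v → Φ τ v ≡ Φ τ' v
  Φ-cong (inj₁ _) = sumFin-cong b (λ j → ind-fires-cong τ τ' (inj₂ j) (e (inj₂ j)))
  Φ-cong (inj₂ _) = sumFin-cong a (λ i → ind-fires-cong τ τ' (inj₁ i) (e (inj₁ i)))

Returns : ℕ → Position a b → Set
Returns t τ = ∀ v → Uⁿ t τ v ≡ τ v

returns-U : ∀ {τ : Position a b} t → Returns t τ → Returns t (U τ)
returns-U {τ = τ} t ret v = trans (cong-app (Uⁿ-comm t τ) v) (U-cong ret v)

returns⇒period : ∀ (σ : Position a b) s₀ → 0 < t → Returns t (Uⁿ s₀ σ) → IsPeriod σ t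
returns⇒period {t = t} σ s₀ t>0 ret = t>0 , s₀ , λ s s₀≤s v →
  let (j , s₀+j≡s) = m≤n⇒∃[o]m+o≡n s₀≤s in
  subst (λ s → Uⁿ s σ v ≡ Uⁿ (s + t) σ v) s₀+j≡s (sym (begin
    Uⁿ (s₀ + j + t) σ v        ≡⟨ cong-app (Uⁿ-+ (s₀ + j) t σ) v ⟩
    Uⁿ t (Uⁿ (s₀ + j) σ) v     ≡⟨ cong (λ ρ → Uⁿ t ρ v) (Uⁿ-+ s₀ j σ) ⟩
    Uⁿ t (Uⁿ j (Uⁿ s₀ σ)) v    ≡⟨ returns-Uⁿ j v ⟩
    Uⁿ j (Uⁿ s₀ σ) v           ≡⟨ cong-app (sym (Uⁿ-+ s₀ j σ)) v ⟩
    Uⁿ (s₀ + j) σ v            ∎))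
  where
  open ≡-Reasoning
  returns-Uⁿ : ∀ j → Returns t (Uⁿ j (Uⁿ s₀ σ))
  returns-Uⁿ zero    = ret
  returns-Uⁿ (suc j) = returns-U t (returns-Uⁿ j)

Φ≤deg : ∀ (τ : Position a b) v → Φ τ v ≤ deg v
Φ≤deg {a} {b} τ (inj₁ _) = sumFin-ind≤ b _
Φ≤deg {a} {b} τ (inj₂ _) = sumFin-ind≤ a _

Bounded : Position a b → Set
Bounded τ = ∀ v → τ v < deg v + deg v

confined⇒bounded : ∀ {σ : Position a b} → Confined σ → Bounded σ
confined⇒bounded {σ = σ} conf v = <-≤-trans (proj₂ (conf v)) (+-monoˡ-≤ (deg v) (Φ≤deg σ v))

bounded-U : ∀ {τ : Position a b} → Bounded τ → Bounded (U τ)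
bounded-U {τ = τ} bnd v = +-mono-<-≤ (resid-< (bnd v)) (Φ≤deg τ v)

bounded-Uⁿ : ∀ {τ : Position a b} t → Bounded τ → Bounded (Uⁿ t τ)
bounded-Uⁿ zero    bnd = bnd
bounded-Uⁿ (suc t) bnd = bounded-U (bounded-Uⁿ t bnd)

-- In a bounded position every degree is positive, so it can be cancelled.
deg-cancel : ∀ {τ : Position a b} {m n} → Bounded τ → ∀ v → deg v * m ≡ deg v * n → m ≡ n
deg-cancel bnd v e with deg v | bnd v
... | suc d | _ = *-cancelˡ-≡ _ _ (suc d) e

-- Sum of an observable along the first t positions of the orbit of τ.
-- The firing count u t τ v is the instance obs ρ = ind (fires ρ v).
orbitSum : (Position a b → ℕ) → Position a b → ℕ → ℕ
orbitSum obs τ t = sumBelow t (λ r → obs (Uⁿ r τ))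

received : Position a b → Vertex a b → ℕ → ℕ
received τ v t = orbitSum (λ ρ → Φ ρ v) τ t

orbitSum-slide : ∀ (obs : Position a b → ℕ) τ t → obs τ ≡ obs (Uⁿ t τ) →
  orbitSum obs (U τ) t ≡ orbitSum obs τ t
orbitSum-slide obs τ t edge =
  trans (sumBelow-cong t (λ r → cong obs (Uⁿ-comm r τ)))
        (sumBelow-slide (λ r → obs (Uⁿ r τ)) t edge)

step-balance : ∀ (τ : Position a b) v → U τ v + deg v * ind (fires τ v) ≡ τ v + Φ τ v
step-balance τ v with fires τ v in fired
... | true  = begin
  τ v ∸ deg v + Φ τ v + deg v * 1 ≡⟨ solve 3 (λ r p q → r :+ p :+ q := r :+ q :+ p) refl (τ v ∸ deg v) (Φ τ v) _ ⟩
  τ v ∸ deg v + deg v * 1 + Φ τ v ≡⟨ cong (λ z → τ v ∸ deg v + z + Φ τ v) (*-identityʳ (deg v)) ⟩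
  τ v ∸ deg v + deg v + Φ τ v     ≡⟨ cong (_+ Φ τ v) (m∸n+n≡m (≤ᵇ⇒≤ (deg v) (τ v) (subst T (sym fired) _))) ⟩
  τ v + Φ τ v                     ∎
  where open ≡-Reasoning
... | false = trans (cong (τ v + Φ τ v +_) (*-zeroʳ (deg v))) (+-identityʳ _)

conservation : ∀ (τ : Position a b) v t → Uⁿ t τ v + deg v * u t τ v ≡ τ v + received τ v t
conservation τ v zero    = cong (τ v +_) (*-zeroʳ (deg v))
conservation τ v (suc t) = begin
  U ρ v + deg v * (u t τ v + ind (fires ρ v))
    ≡⟨ cong (U ρ v +_) (*-distribˡ-+ (deg v) (u t τ v) _) ⟩
  U ρ v + (deg v * u t τ v + deg v * ind (fires ρ v))
    ≡⟨ solve 3 (λ x y z → x :+ (y :+ z) := (x :+ z) :+ y) refl (U ρ v) _ _ ⟩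
  U ρ v + deg v * ind (fires ρ v) + deg v * u t τ v
    ≡⟨ cong (_+ deg v * u t τ v) (step-balance ρ v) ⟩
  ρ v + Φ ρ v + deg v * u t τ v
    ≡⟨ solve 3 (λ x y z → (x :+ y) :+ z := (x :+ z) :+ y) refl (ρ v) _ _ ⟩
  ρ v + deg v * u t τ v + Φ ρ v
    ≡⟨ cong (_+ Φ ρ v) (conservation τ v t) ⟩
  τ v + received τ v t + Φ ρ v
    ≡⟨ +-assoc (τ v) _ _ ⟩
  τ v + received τ v (suc t) ∎
  where open ≡-Reasoning
        ρ = Uⁿ t τ

return⇒balance : ∀ (τ : Position a b) v t → Uⁿ t τ v ≡ τ v → deg v * u t τ v ≡ received τ v t
return⇒balance τ v t ret =
  +-cancelˡ-≡ (τ v) _ _ (trans (cong (_+ deg v * u t τ v) (sym ret)) (conservation τ v t))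

balance⇒return : ∀ (τ : Position a b) v t → u t τ v ≡ k → received τ v t ≡ deg v * k → Uⁿ t τ v ≡ τ v
balance⇒return {k = k} τ v t fired recv = +-cancelʳ-≡ (deg v * k) _ _ (begin
  Uⁿ t τ v + deg v * k         ≡⟨ cong (λ z → Uⁿ t τ v + deg v * z) (sym fired) ⟩
  Uⁿ t τ v + deg v * u t τ v   ≡⟨ conservation τ v t ⟩
  τ v + received τ v t         ≡⟨ cong (τ v +_) recv ⟩
  τ v + deg v * k              ∎)
  where open ≡-Reasoning

advance : ∀ (τ : Position a b) t k v → Bounded τ → received τ v t ≡ deg v * k → Φ (Uⁿ t τ) v ≡ Φ τ v →
  Uⁿ t (U τ) v ≡ U τ v × u t (U τ) v ≡ k
advance τ t k v bnd recv edge = ret , deg-cancel bnd v (begin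
  deg v * u t (U τ) v  ≡⟨ return⇒balance (U τ) v t ret ⟩
  received (U τ) v t   ≡⟨ orbitSum-slide (λ ρ → Φ ρ v) τ t (sym edge) ⟩
  received τ v t       ≡⟨ recv ⟩
  deg v * k            ∎)
  where
  open ≡-Reasoning
  congruent : Uⁿ t τ v + deg v * u t τ v ≡ τ v + deg v * k
  congruent = trans (conservation τ v t) (cong (τ v +_) recv)
  ret : Uⁿ t (U τ) v ≡ U τ v
  ret = trans (cong-app (Uⁿ-comm t τ) v)
    (cong₂ _+_ (resid-cong {deg v} (u t τ v) k (bounded-Uⁿ t bnd v) (bnd v) congruent) edge)

received-L : ∀ (τ : Position a b) i t → received τ (inj₁ i) t ≡ sumFin b (λ j → u t τ (inj₂ j))
received-L {b = b} τ i t = sumBelow-sumFin t b (λ r j → F τ (inj₂ j) r)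

received-R : ∀ (τ : Position a b) j t → received τ (inj₂ j) t ≡ sumFin a (λ i → u t τ (inj₁ i))
received-R {a = a} τ j t = sumBelow-sumFin t a (λ r i → F τ (inj₁ i) r)

uniform-firing⇒returns : ∀ (τ : Position a b) t → (∀ v → u t τ v ≡ k) → Returns t τ
uniform-firing⇒returns {a} {b} {k} τ t fired (inj₁ i) = balance⇒return τ (inj₁ i) t (fired (inj₁ i))
  (trans (received-L τ i t) (trans (sumFin-cong b (λ j → fired (inj₂ j))) (sumFin-const b k)))
uniform-firing⇒returns {a} {b} {k} τ t fired (inj₂ j) = balance⇒return τ (inj₂ j) t (fired (inj₂ j))
  (trans (received-R τ j t) (trans (sumFin-cong a (λ i → fired (inj₁ i))) (sumFin-const a k)))

-- Period ⇒ condition: in a returning window all L-vertices fire equally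
-- often, so their total number of firings is a multiple of a.
returns⇒L-uniform : ∀ (τ : Position a b) t → Bounded τ → Returns t τ →
  ∃ λ k → sumFin a (λ i → u t τ (inj₁ i)) ≡ k * a
returns⇒L-uniform {a} {b} τ t bnd ret = sumFin-uniform a _ λ i i' →
  deg-cancel bnd (inj₁ i) (trans (L-balance i) (sym (L-balance i')))
  where
  L-balance : ∀ i → b * u t τ (inj₁ i) ≡ sumFin b (λ j → u t τ (inj₂ j))
  L-balance i = trans (return⇒balance τ (inj₁ i) t (ret (inj₁ i))) (received-L τ i t)

L-uniform⇒returns : ∀ (τ : Position a b) t k → Bounded τ →
  sumFin a (λ i → u t τ (inj₁ i)) ≡ k * a →
  (∀ i → ind (fires τ (inj₁ i)) ≡ ind (fires (Uⁿ t τ) (inj₁ i))) →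
  Returns t (U (U τ))
L-uniform⇒returns {a} {b} τ t k bnd total edgeL = uniform-firing⇒returns (U (U τ)) t fired₂
  where
  -- R receives the k·a L-firings: it returns from U τ on and fires k times.
  advanceR : ∀ j → Uⁿ t (U τ) (inj₂ j) ≡ U τ (inj₂ j) × u t (U τ) (inj₂ j) ≡ k
  advanceR j = advance τ t k (inj₂ j) bnd
    (trans (received-R τ j t) (trans total (*-comm k a)))
    (sumFin-cong a (λ i → sym (edgeL i)))
  -- L then receives b·k chips: it returns from U (U τ) on and fires k times.
  advanceL : ∀ i → Uⁿ t (U (U τ)) (inj₁ i) ≡ U (U τ) (inj₁ i) × u t (U (U τ)) (inj₁ i) ≡ k
  advanceL i = advance (U τ) t k (inj₁ i) (bounded-U bnd)
    (trans (received-L (U τ) i t) (trans (sumFin-cong b (λ j → proj₂ (advanceR j))) (sumFin-const b k)))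
    (sumFin-cong b (λ j → ind-fires-cong (Uⁿ t (U τ)) (U τ) (inj₂ j) (proj₁ (advanceR j))))
  -- R fires as often from U (U τ) as from U τ, since it returned at U τ.
  fired₂ : ∀ v → u t (U (U τ)) v ≡ k
  fired₂ (inj₁ i) = proj₂ (advanceL i)
  fired₂ (inj₂ j) = trans
    (orbitSum-slide (λ ρ → ind (fires ρ (inj₂ j))) (U τ) t (sym (ind-fires-cong (Uⁿ t (U τ)) (U τ) (inj₂ j) (proj₁ (advanceR j)))))
    (proj₂ (advanceR j))

α-window : ∀ (σ : Position a b) t m → α σ t m ≡ sumFin a (λ i → u t (Uⁿ m σ) (inj₁ i))
α-window {a} σ t m = sumFin-cong a λ i → begin
  u (m + t) σ (inj₁ i) ∸ u m σ (inj₁ i)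
    ≡⟨ cong (_∸ u m σ (inj₁ i)) (sumBelow-split (F σ (inj₁ i)) m t) ⟩
  u m σ (inj₁ i) + sumBelow t (λ r → F σ (inj₁ i) (m + r)) ∸ u m σ (inj₁ i)
    ≡⟨ m+n∸m≡n (u m σ (inj₁ i)) _ ⟩
  sumBelow t (λ r → F σ (inj₁ i) (m + r))
    ≡⟨ sumBelow-cong t (λ r → cong (λ ρ → ind (fires ρ (inj₁ i))) (Uⁿ-+ m r σ)) ⟩
  u t (Uⁿ m σ) (inj₁ i) ∎
  where open ≡-Reasoning

good⇒period : ∀ (σ : Position a b) → Confined σ → GoodT σ t → IsPeriod σ t
good⇒period {t = t} σ conf (t>0 , m , k , αeq , Feq) =
  returns⇒period σ (suc (suc m)) t>0
    (L-uniform⇒returns (Uⁿ m σ) t k (bounded-Uⁿ m (confined⇒bounded conf))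
      (trans (sym (α-window σ t m)) αeq)
      (λ i → trans (Feq i) (cong (λ ρ → ind (fires ρ (inj₁ i))) (Uⁿ-+ m t σ))))

period⇒good : ∀ (σ : Position a b) → Confined σ → IsPeriod σ t → GoodT σ t
period⇒good {t = t} σ conf (t>0 , s₀ , periodic) =
  let (k , total) = returns⇒L-uniform (Uⁿ s₀ σ) t (bounded-Uⁿ s₀ (confined⇒bounded conf)) ret in
  t>0 , s₀ , k , trans (α-window σ t s₀) total ,
  λ i → ind-fires-cong (Uⁿ s₀ σ) (Uⁿ (s₀ + t) σ) (inj₁ i) (periodic s₀ ≤-refl (inj₁ i))
  where
  ret : Returns t (Uⁿ s₀ σ)
  ret v = trans (sym (cong-app (Uⁿ-+ s₀ t σ) v)) (sym (periodic s₀ ≤-refl v))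

lemma3p4 : (a b : ℕ) (σ : Position a b) → Confined σ →
    (t : ℕ) → IsLeast (GoodT σ) t → IsLeast (IsPeriod σ) t
lemma3p4 a b σ conf t (good , least) =
  good⇒period σ conf good , λ p isPeriod → least p (period⇒good σ conf isPeriod)
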